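{- Let $n\ge 2$ and $k\ge 1$ be integers and $T_m=m(m+1)/2$. The Inscribed Graph $I_n^k$ has exactly $T_n^k$ vertices and exactly $$E(I_n^k)=\sum_{i=1}^{k}3\,T_{n-1}\cdot T_n^{\,i-1}$$ edges.
   Context: $T_m=m(m+1)/2$ denotes the $m$-th triangular number. For an integer $n\ge 2$, the generator pattern $F_n$ is an equilateral triangle of side length $n$ (horizontal base, apex up) subdivided by lines parallel to its sides into $n^2$ unit equilateral triangles ("tiles"); the $T_n$ tiles pointing upwards are dark and the $T_{n-1}$ tiles pointing downwards are white. Set $F_n(1)=F_n$, and for $k\ge 2$ obtain $F_n(k)$ from $F_n$ by replacing every dark tile with a correspondingly scaled copy of $F_n(k-1)$. The Inscribed Graph $I_n^k$ has as vertices the centroids of the dark tiles of $F_n(k)$, two vertices being adjacent iff the corresponding two distinct dark tiles share at least one point (are node-neighbours). -}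

module Defs where

open import Data.Bool using (Bool; true; false; _∧_; T; T?)
open import Data.Nat using (ℕ; zero; suc; _+_; _*_; _∸_; _^_; _≤_; _≤ᵇ_; _≡ᵇ_; _/_; _%_; NonZero)
open import Data.Nat.Properties using (_≟_; m^n≢0)
open import Data.Product using (_×_; _,_; ∃; Σ; proj₁; proj₂)
open import Data.Product.Properties using (≡-dec)
open import Data.List using (List; []; _∷_; _++_; map; concatMap; upTo; filter; length)
open import Data.Nat.ListAction using (sum)
open import Data.List.Membership.Propositional using (_∈_; find; lose)
open import Data.List.Relation.Unary.Any using (any?)
open import Data.List.Membership.DecPropositional (≡-dec _≟_ _≟_) using (_∈?_)
open import Relation.Binary.PropositionalEquality using (_≡_)
open import Relation.Nullary using (Dec; ¬_; yes; no)
open import Relation.Nullary.Decidable using (_×-dec_; ¬?)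

Tri : ℕ → ℕ
Tri m = (m * suc m) / 2

-- Fix the triangular lattice with basis vectors
-- e₁ (horizontal) and e₂ (at 60°).  A lattice point is (a , b) ↦ a·e₁ + b·e₂.
-- The upward unit tile with label (a , b) is the triangle with corners
-- (a , b), (a+1 , b), (a , b+1).  The big triangle of side N (apex up,
-- horizontal base) has corners (0,0), (N,0), (0,N); its upward unit tiles
-- are the labels (a , b) with a + b ≤ N - 1.
Point : Set
Point = ℕ × ℕ

Tile : Set
Tile = ℕ × ℕ

corners : Tile → List Point
corners (a , b) = (a , b) ∷ (suc a , b) ∷ (a , suc b) ∷ []

-- Generator pattern F_n at unit scale: the upward tile (a , b) of the
-- triangle of side n is dark iff a + b ≤ n - 1.
darkGen : ℕ → ℕ → ℕ → Bool
darkGen n a b = (a + b) ≤ᵇ (n ∸ 1)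

-- darkF n k a b = true iff the upward unit tile (a , b) (unit = side 1 where
-- the whole triangle has side n^k) is a dark tile of F_n(k).
--   * k = 0 : the single tile (0,0) (a convenient base; F_n(1) = F_n follows).
--   * k+1  : F_n(k+1) is F_n with each dark tile (of side m = n^k) replaced
--            by a scaled copy of F_n(k): the unit tile (a , b) lies in the
--            big tile (a / m , b / m) at local position (a % m , b % m).
darkF : (n : ℕ) → .{{NonZero n}} → ℕ → ℕ → ℕ → Bool
darkF n zero    a b = (a ≡ᵇ 0) ∧ (b ≡ᵇ 0)
darkF n (suc k) a b =
  darkGen n (a / m) (b / m) ∧ darkF n k (a % m) (b % m)
  where
  m = n ^ k
  instance
    nz : NonZero m
    nz = m^n≢0 n k

grid : ℕ → List Tile
grid N = concatMap (λ a → map (a ,_) (upTo N)) (upTo N)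

vertices : (n : ℕ) → .{{NonZero n}} → ℕ → List Tile
vertices n k = filter (λ t → T? (darkF n k (proj₁ t) (proj₂ t))) (grid (n ^ k))

-- Two distinct (closed, upward unit) tiles are node-neighbours iff they
-- share at least one point, i.e. a common corner.
NodeNeighbours : Tile → Tile → Set
NodeNeighbours s t = (¬ s ≡ t) × ∃ λ p → (p ∈ corners s) × (p ∈ corners t)

nodeNeighbours? : (s t : Tile) → Dec (NodeNeighbours s t)
nodeNeighbours? s t with ≡-dec _≟_ _≟_ s t | any? (_∈? corners t) (corners s)
... | yes s≡t | _ = no λ { (s≢t , _) → s≢t s≡t }
... | no s≢t | yes a = yes (s≢t , find a)
... | no s≢t | no ¬a = no λ { (_ , p , p∈s , p∈t) → ¬a (lose p∈s p∈t) }

pairs : {A : Set} → List A → List (A × A)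
pairs []       = []
pairs (x ∷ xs) = map (x ,_) xs ++ pairs xs

edges : (n : ℕ) → .{{NonZero n}} → ℕ → List (Tile × Tile)
edges n k = filter (λ e → nodeNeighbours? (proj₁ e) (proj₂ e)) (pairs (vertices n k))

numVertices : (n : ℕ) → .{{NonZero n}} → ℕ → ℕ
numVertices n k = length (vertices n k)

numEdges : (n : ℕ) → .{{NonZero n}} → ℕ → ℕ
numEdges n k = length (edges n k)

edgeFormula : ℕ → ℕ → ℕ
edgeFormula n k = sum (map (λ j → 3 * Tri (n ∸ 1) * Tri n ^ j) (upTo k))

-- F_n(k+1) consists of T_n copies of F_n(k), one for each dark tile of F_n, so I_n^k has T_n^k
-- vertices.  In lattice coordinates the up-tiles touching (a , b) are (a , b ± 1), (a ± 1 , b)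
-- and (a ± 1 , b ∓ 1), so orienting each edge forward splits the edges into three classes of
-- steps.  Two copies of F_n(k) touch only where the corresponding dark tiles of F_n touch, and
-- then in a single pair of corner tiles.  Hence each class satisfies E(k+1) = T_n E(k) + T_{n-1}
-- with E(0) = 0, i.e. E(k) = Σ_{j<k} T_{n-1} T_n^j, and the edge count is 3 E(k).  This holds
-- for all n ≥ 1 and k ≥ 0.

module Submission where

open import Data.Bool using (Bool; true; false; _∧_; T; T?)
open import Data.Bool.Properties using (∧-comm; T-≡)
open import Data.Empty using (⊥-elim)
open import Data.List using (List; []; _∷_; _++_; map; concatMap; applyUpTo; filter; length)
open import Data.List.Relation.Unary.Any using (here; there)
open import Data.Nat
  using (ℕ; zero; suc; pred; _+_; _*_; _∸_; _^_; _≤_; _<_; _≡ᵇ_; _≤ᵇ_; z≤n; s≤s; NonZero; >-nonZero⁻¹)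
open import Data.Nat.DivMod
open import Data.Nat.Divisibility using (n∣m*n)
open import Data.Nat.ListAction using (sum)
open import Data.Nat.Properties
open import Algebra.Properties.CommutativeSemigroup +-commutativeSemigroup
  using () renaming (interchange to +-interchange)
open import Algebra.Properties.CommutativeSemigroup *-commutativeSemigroup
  using () renaming (interchange to *-interchange)
open import Data.Nat.Tactic.RingSolver using (solve-∀)
open import Data.Product using (_×_; _,_; proj₁; proj₂; uncurry)
open import Function using (_∘_; id; mk⇔)
open import Function.Bundles using (Equivalence)
open import Relation.Binary.PropositionalEquality
open import Relation.Nullary using (Dec; does)
open import Relation.Nullary.Decidable using (dec-false; does-⇔)

open import Defs

𝟙 : Bool → ℕ
𝟙 true  = 1
𝟙 false = 0

𝟙-∧ : ∀ x y → 𝟙 (x ∧ y) ≡ 𝟙 x * 𝟙 y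
𝟙-∧ true  y = sym (+-identityʳ (𝟙 y))
𝟙-∧ false y = refl

𝟙-idem : ∀ x → 𝟙 x * 𝟙 x ≡ 𝟙 x
𝟙-idem true  = refl
𝟙-idem false = refl

𝟙-∧-interchange : ∀ a b c d → 𝟙 (a ∧ b) * 𝟙 (c ∧ d) ≡ (𝟙 a * 𝟙 c) * (𝟙 b * 𝟙 d)
𝟙-∧-interchange a b c d
  rewrite 𝟙-∧ a b | 𝟙-∧ c d = *-interchange (𝟙 a) (𝟙 b) (𝟙 c) (𝟙 d)

𝟙-∧-shared : ∀ g x y → 𝟙 (g ∧ x) * 𝟙 (g ∧ y) ≡ 𝟙 g * (𝟙 x * 𝟙 y)
𝟙-∧-shared g x y = trans (𝟙-∧-interchange g x g y) (cong (_* (𝟙 x * 𝟙 y)) (𝟙-idem g))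

𝟙-implied : ∀ {a b} → (T b → T a) → 𝟙 a * 𝟙 b ≡ 𝟙 b
𝟙-implied {true}  {b}     _   = +-identityʳ (𝟙 b)
𝟙-implied {false} {false} _   = refl
𝟙-implied {false} {true}  b⇒a = ⊥-elim (b⇒a _)

∑< : ℕ → (ℕ → ℕ) → ℕ
∑< zero    f = 0
∑< (suc N) f = f 0 + ∑< N (f ∘ suc)

syntax ∑< N (λ i → e) = ∑[ i < N ] e

∑-cong< : ∀ N {f g : ℕ → ℕ} → (∀ i → i < N → f i ≡ g i) → ∑< N f ≡ ∑< N g
∑-cong< zero    f≡g = refl
∑-cong< (suc N) f≡g = cong₂ _+_ (f≡g 0 (s≤s z≤n)) (∑-cong< N λ i i<N → f≡g (suc i) (s≤s i<N))

∑-cong : ∀ N {f g : ℕ → ℕ} → (∀ i → f i ≡ g i) → ∑< N f ≡ ∑< N g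
∑-cong N f≡g = ∑-cong< N λ i _ → f≡g i

∑-≡0 : ∀ N {f : ℕ → ℕ} → (∀ i → i < N → f i ≡ 0) → ∑< N f ≡ 0
∑-≡0 zero    f≡0 = refl
∑-≡0 (suc N) f≡0 = cong₂ _+_ (f≡0 0 (s≤s z≤n)) (∑-≡0 N λ i i<N → f≡0 (suc i) (s≤s i<N))

∑-+ : ∀ N (f g : ℕ → ℕ) → ∑[ i < N ] (f i + g i) ≡ ∑< N f + ∑< N g
∑-+ zero    f g = refl
∑-+ (suc N) f g = trans (cong (f 0 + g 0 +_) (∑-+ N (f ∘ suc) (g ∘ suc)))
                        (+-interchange (f 0) (g 0) (∑< N (f ∘ suc)) (∑< N (g ∘ suc)))

∑-*ˡ : ∀ N c (f : ℕ → ℕ) → ∑[ i < N ] (c * f i) ≡ c * ∑< N f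
∑-*ˡ zero    c f = sym (*-zeroʳ c)
∑-*ˡ (suc N) c f = trans (cong (c * f 0 +_) (∑-*ˡ N c (f ∘ suc))) (sym (*-distribˡ-+ c (f 0) _))

∑-*ʳ : ∀ N c (f : ℕ → ℕ) → ∑[ i < N ] (f i * c) ≡ ∑< N f * c
∑-*ʳ N c f = trans (∑-cong N λ i → *-comm (f i) c) (trans (∑-*ˡ N c f) (*-comm c (∑< N f)))

∑∑-*ˡ : ∀ M N c (f : ℕ → ℕ → ℕ) → ∑[ i < M ] ∑[ j < N ] (c * f i j) ≡ c * ∑[ i < M ] ∑[ j < N ] f i j
∑∑-*ˡ M N c f = trans (∑-cong M λ i → ∑-*ˡ N c (f i)) (∑-*ˡ M c _)

∑-split : ∀ M N (f : ℕ → ℕ) → ∑< (M + N) f ≡ ∑< M f + ∑[ i < N ] f (M + i)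
∑-split zero    N f = refl
∑-split (suc M) N f = trans (cong (f 0 +_) (∑-split M N (f ∘ suc))) (sym (+-assoc (f 0) _ _))

∑-last : ∀ N (f : ℕ → ℕ) → ∑< (suc N) f ≡ ∑< N f + f N
∑-last N f = begin
  ∑< (suc N) f                  ≡⟨ cong (λ M → ∑< M f) (+-comm 1 N) ⟩
  ∑< (N + 1) f                  ≡⟨ ∑-split N 1 f ⟩
  ∑< N f + (f (N + 0) + 0)      ≡⟨ cong (∑< N f +_) (trans (+-identityʳ _) (cong f (+-identityʳ N))) ⟩
  ∑< N f + f N                  ∎
  where open ≡-Reasoning

∑-blocks : ∀ n m (f : ℕ → ℕ) → ∑< (n * m) f ≡ ∑[ q < n ] ∑[ r < m ] f (q * m + r)
∑-blocks zero    m f = refl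
∑-blocks (suc n) m f = trans (∑-split m (n * m) f) (cong (∑< m f +_)
  (trans (∑-blocks n m _) (∑-cong n λ q → ∑-cong m λ r → cong f (sym (+-assoc m (q * m) r)))))

∑-comm : ∀ M N (f : ℕ → ℕ → ℕ) → ∑[ i < M ] ∑[ j < N ] f i j ≡ ∑[ j < N ] ∑[ i < M ] f i j
∑-comm zero    N f = sym (∑-≡0 N λ _ _ → refl)
∑-comm (suc M) N f = trans (cong (∑< N (f 0) +_) (∑-comm M N (f ∘ suc))) (sym (∑-+ N (f 0) _))

∑³-+ : ∀ A B C (f g : ℕ → ℕ → ℕ → ℕ) →
       ∑[ i < A ] ∑[ j < B ] ∑[ k < C ] (f i j k + g i j k) ≡
       ∑[ i < A ] ∑[ j < B ] ∑[ k < C ] f i j k + ∑[ i < A ] ∑[ j < B ] ∑[ k < C ] g i j k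
∑³-+ A B C f g = trans (∑-cong A λ i → trans (∑-cong B λ j → ∑-+ C (f i j) (g i j)) (∑-+ B _ _)) (∑-+ A _ _)

∑³-separate : ∀ A B (γ : ℕ → ℕ → ℕ) (δ : ℕ → ℕ) →
              ∑[ q < A ] ∑[ r < B ] ∑[ p < A ] (γ q p * δ r) ≡ ∑[ q < A ] ∑[ p < A ] γ q p * ∑[ r < B ] δ r
∑³-separate A B γ δ = trans (∑-cong A λ q → trans (∑-cong B λ r → ∑-*ʳ A (δ r) (γ q)) (∑-*ˡ B (∑< A (γ q)) δ))
                            (∑-*ʳ A (∑< B δ) (λ q → ∑< A (γ q)))

∑⁴-separate : ∀ A B (γ δ : ℕ → ℕ → ℕ) →
              ∑[ q < A ] ∑[ r < B ] ∑[ p < A ] ∑[ s < B ] (γ q p * δ r s) ≡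
              ∑[ q < A ] ∑[ p < A ] γ q p * ∑[ r < B ] ∑[ s < B ] δ r s
∑⁴-separate A B γ δ = trans (∑-cong A λ q → ∑-cong B λ r → ∑-cong A λ p → ∑-*ˡ B (γ q p) (δ r))
                            (∑³-separate A B γ (λ r → ∑< B (δ r)))

∑-affineRecurrence : ∀ (f : ℕ → ℕ) a c → f 0 ≡ 0 → (∀ k → f (suc k) ≡ c * f k + a) →
                     ∀ k → f k ≡ ∑[ j < k ] (a * c ^ j)
∑-affineRecurrence f a c f0≡0 step zero    = f0≡0
∑-affineRecurrence f a c f0≡0 step (suc k) = begin
  f (suc k)                              ≡⟨ step k ⟩
  c * f k + a                            ≡⟨ cong (λ x → c * x + a) (∑-affineRecurrence f a c f0≡0 step k) ⟩
  c * ∑[ j < k ] (a * c ^ j) + a         ≡⟨ +-comm _ a ⟩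
  a + c * ∑[ j < k ] (a * c ^ j)         ≡⟨ cong₂ _+_ (*-identityʳ a) (∑-*ˡ k c _) ⟨
  a * 1 + ∑[ j < k ] (c * (a * c ^ j))   ≡⟨ cong (a * 1 +_) (∑-cong k λ j → exchange c a (c ^ j)) ⟩
  a * 1 + ∑[ j < k ] (a * (c * c ^ j))   ∎
  where
  open ≡-Reasoning
  exchange : ∀ x y z → x * (y * z) ≡ y * (x * z)
  exchange = solve-∀

∑-single : ∀ N e (f : ℕ → ℕ) → (∀ i → i ≢ e → f i ≡ 0) → (∀ i → N ≤ i → f i ≡ 0) → ∑< N f ≡ f e
∑-single zero    e       f off out = sym (out e z≤n)
∑-single (suc N) zero    f off out = trans (cong (f 0 +_) (∑-≡0 N λ i _ → off (suc i) λ ())) (+-identityʳ _)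
∑-single (suc N) (suc e) f off out = trans (cong (_+ ∑< N (f ∘ suc)) (off 0 λ ()))
  (∑-single N e (f ∘ suc) (λ i i≢e → off (suc i) (i≢e ∘ suc-injective)) λ i N≤i → out (suc i) (s≤s N≤i))

∑-select : ∀ N e (δ f : ℕ → ℕ) → δ e ≡ 1 → (∀ i → i ≢ e → δ i ≡ 0) → (∀ i → N ≤ i → f i ≡ 0) →
           ∑[ i < N ] (δ i * f i) ≡ f e
∑-select N e δ f δe≡1 off out = begin
  ∑[ i < N ] (δ i * f i)  ≡⟨ ∑-single N e _ (λ i i≢e → cong (_* f i) (off i i≢e))
                                              (λ i N≤i → trans (cong (δ i *_) (out i N≤i)) (*-zeroʳ (δ i))) ⟩
  δ e * f e               ≡⟨ cong (_* f e) δe≡1 ⟩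
  1 * f e                 ≡⟨ *-identityˡ (f e) ⟩
  f e                     ∎
  where open ≡-Reasoning

private
  variable
    A B : Set

sumMap : (A → ℕ) → List A → ℕ
sumMap g xs = sum (map g xs)

sumMap-++ : ∀ (g : A → ℕ) xs ys → sumMap g (xs ++ ys) ≡ sumMap g xs + sumMap g ys
sumMap-++ g []       ys = refl
sumMap-++ g (x ∷ xs) ys = trans (cong (g x +_) (sumMap-++ g xs ys)) (sym (+-assoc (g x) _ _))

sumMap-cong : ∀ {g h : A → ℕ} → (∀ x → g x ≡ h x) → ∀ xs → sumMap g xs ≡ sumMap h xs
sumMap-cong g≡h []       = refl
sumMap-cong g≡h (x ∷ xs) = cong₂ _+_ (g≡h x) (sumMap-cong g≡h xs)

sumMap-≡0 : ∀ {g : A → ℕ} → (∀ x → g x ≡ 0) → ∀ xs → sumMap g xs ≡ 0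
sumMap-≡0 g≡0 []       = refl
sumMap-≡0 g≡0 (x ∷ xs) = cong₂ _+_ (g≡0 x) (sumMap-≡0 g≡0 xs)

sumMap-+ : ∀ (g h : A → ℕ) xs → sumMap (λ x → g x + h x) xs ≡ sumMap g xs + sumMap h xs
sumMap-+ g h []       = refl
sumMap-+ g h (x ∷ xs) = trans (cong (g x + h x +_) (sumMap-+ g h xs))
                              (+-interchange (g x) (h x) (sumMap g xs) (sumMap h xs))

sumMap-map : ∀ (g : B → ℕ) (f : A → B) xs → sumMap g (map f xs) ≡ sumMap (g ∘ f) xs
sumMap-map g f []       = refl
sumMap-map g f (x ∷ xs) = cong (g (f x) +_) (sumMap-map g f xs)

sumMap-concatMap : ∀ (g : B → ℕ) (f : A → List B) xs →
                   sumMap g (concatMap f xs) ≡ sumMap (sumMap g ∘ f) xs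
sumMap-concatMap g f []       = refl
sumMap-concatMap g f (x ∷ xs) =
  trans (sumMap-++ g (f x) (concatMap f xs)) (cong (sumMap g (f x) +_) (sumMap-concatMap g f xs))

length-filter : ∀ {P : A → Set} (P? : ∀ x → Dec (P x)) xs →
                length (filter P? xs) ≡ sumMap (𝟙 ∘ does ∘ P?) xs
length-filter P? []       = refl
length-filter P? (x ∷ xs) with does (P? x)
... | true  = cong suc (length-filter P? xs)
... | false = length-filter P? xs

sumMap-filter : ∀ (p : A → Bool) (g : A → ℕ) xs →
                sumMap g (filter (T? ∘ p) xs) ≡ sumMap (λ x → 𝟙 (p x) * g x) xs
sumMap-filter p g []       = refl
sumMap-filter p g (x ∷ xs) with p x
... | true  = cong₂ _+_ (sym (+-identityʳ (g x))) (sumMap-filter p g xs)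
... | false = sumMap-filter p g xs

sumMap-applyUpTo : ∀ (g f : ℕ → ℕ) N → sumMap g (applyUpTo f N) ≡ ∑[ i < N ] g (f i)
sumMap-applyUpTo g f zero    = refl
sumMap-applyUpTo g f (suc N) = cong (g (f 0) +_) (sumMap-applyUpTo g (f ∘ suc) N)

sumMap-grid : ∀ (g : Tile → ℕ) N → sumMap g (grid N) ≡ ∑[ a < N ] ∑[ b < N ] g (a , b)
sumMap-grid g N = begin
  sumMap g (grid N)
    ≡⟨ sumMap-concatMap g row (applyUpTo id N) ⟩
  sumMap (sumMap g ∘ row) (applyUpTo id N)
    ≡⟨ sumMap-applyUpTo (sumMap g ∘ row) id N ⟩
  ∑[ a < N ] sumMap g (row a)
    ≡⟨ ∑-cong N (λ a → sumMap-map g (a ,_) (applyUpTo id N)) ⟩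
  ∑[ a < N ] sumMap (λ b → g (a , b)) (applyUpTo id N)
    ≡⟨ ∑-cong N (λ a → sumMap-applyUpTo (λ b → g (a , b)) id N) ⟩
  ∑[ a < N ] ∑[ b < N ] g (a , b) ∎
  where
  open ≡-Reasoning
  row : ℕ → List Tile
  row a = map (a ,_) (applyUpTo id N)

sumMap-pairs-∷ : ∀ (g : A × A → ℕ) x xs →
                 sumMap g (pairs (x ∷ xs)) ≡ sumMap (λ y → g (x , y)) xs + sumMap g (pairs xs)
sumMap-pairs-∷ g x xs = trans (sumMap-++ g (map (x ,_) xs) (pairs xs)) (cong (_+ _) (sumMap-map g (x ,_) xs))

sumMap-pairs-filter : ∀ (p : A → Bool) (w : A → A → ℕ) xs →
  sumMap (uncurry w) (pairs (filter (T? ∘ p) xs)) ≡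
  sumMap (uncurry λ x y → 𝟙 (p x) * (𝟙 (p y) * w x y)) (pairs xs)
sumMap-pairs-filter p w []       = refl
sumMap-pairs-filter p w (x ∷ xs) with p x in px
... | true  = begin
  sumMap W (pairs (x ∷ ys))
    ≡⟨ sumMap-pairs-∷ W x ys ⟩
  sumMap (w x) ys + sumMap W (pairs ys)
    ≡⟨ cong₂ _+_ (sumMap-filter p (w x) xs) (sumMap-pairs-filter p w xs) ⟩
  sumMap (λ y → 𝟙 (p y) * w x y) xs + sumMap W′ (pairs xs)
    ≡⟨ cong (_+ sumMap W′ (pairs xs)) (sumMap-cong weight xs) ⟩
  sumMap (λ y → W′ (x , y)) xs + sumMap W′ (pairs xs)
    ≡⟨ sumMap-pairs-∷ W′ x xs ⟨
  sumMap W′ (pairs (x ∷ xs)) ∎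
  where
  open ≡-Reasoning
  ys = filter (T? ∘ p) xs
  W  = uncurry w
  W′ = uncurry λ x y → 𝟙 (p x) * (𝟙 (p y) * w x y)
  weight : ∀ y → 𝟙 (p y) * w x y ≡ W′ (x , y)
  weight y = sym (trans (cong (λ b → 𝟙 b * (𝟙 (p y) * w x y)) px) (*-identityˡ _))
... | false = begin
  sumMap W (pairs ys)
    ≡⟨ sumMap-pairs-filter p w xs ⟩
  sumMap W′ (pairs xs)
    ≡⟨ cong (_+ sumMap W′ (pairs xs)) (sumMap-≡0 weight xs) ⟨
  sumMap (λ y → W′ (x , y)) xs + sumMap W′ (pairs xs)
    ≡⟨ sumMap-pairs-∷ W′ x xs ⟨
  sumMap W′ (pairs (x ∷ xs)) ∎
  where
  open ≡-Reasoning
  ys = filter (T? ∘ p) xs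
  W  = uncurry w
  W′ = uncurry λ x y → 𝟙 (p x) * (𝟙 (p y) * w x y)
  weight : ∀ y → W′ (x , y) ≡ 0
  weight y = cong (λ b → 𝟙 b * (𝟙 (p y) * w x y)) px

sumMap-pairs-double : ∀ (w : A → A → ℕ) → (∀ x y → w x y ≡ w y x) → (∀ x → w x x ≡ 0) → ∀ xs →
                      2 * sumMap (uncurry w) (pairs xs) ≡ sumMap (λ x → sumMap (w x) xs) xs
sumMap-pairs-double w w-sym w-diag []       = refl
sumMap-pairs-double w w-sym w-diag (x ∷ xs) = begin
  2 * sumMap (uncurry w) (pairs (x ∷ xs))      ≡⟨ cong (2 *_) (sumMap-pairs-∷ (uncurry w) x xs) ⟩
  2 * (S + P)                                  ≡⟨ *-distribˡ-+ 2 S P ⟩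
  2 * S + 2 * P                                ≡⟨ cong₂ _+_ (cong (S +_) (+-identityʳ S))
                                                            (sumMap-pairs-double w w-sym w-diag xs) ⟩
  (S + S) + R                                  ≡⟨ +-assoc S S R ⟩
  S + (S + R)                                  ≡⟨ cong₂ (λ u v → u + (v + R)) (cong (_+ S) (sym (w-diag x)))
                                                                             (sumMap-cong (w-sym x) xs) ⟩
  (w x x + S) + (sumMap (λ y → w y x) xs + R)  ≡⟨ cong (w x x + S +_) (sym (sumMap-+ (λ y → w y x) _ xs)) ⟩
  sumMap (λ y → sumMap (w y) (x ∷ xs)) (x ∷ xs) ∎
  where
  open ≡-Reasoning
  S = sumMap (w x) xs
  P = sumMap (uncurry w) (pairs xs)
  R = sumMap (λ y → sumMap (w y) xs) xs

-- Up-tiles sharing a point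

data Offset : Set where
  same next prev far : Offset

offset : ℕ → ℕ → Offset
offset (suc a)       (suc c)       = offset a c
offset zero          zero          = same
offset zero          (suc zero)    = next
offset zero          (suc (suc _)) = far
offset (suc zero)    zero          = prev
offset (suc (suc _)) zero          = far

offset-same : ∀ {a c} → offset a c ≡ same → c ≡ a
offset-same {zero}        {zero}        _ = refl
offset-same {zero}        {suc zero}    ()
offset-same {zero}        {suc (suc _)} ()
offset-same {suc zero}    {zero}        ()
offset-same {suc (suc _)} {zero}        ()
offset-same {suc a}       {suc c}       e = cong suc (offset-same e)

offset-next : ∀ {a c} → offset a c ≡ next → c ≡ suc a
offset-next {zero}        {zero}        ()
offset-next {zero}        {suc zero}    _ = refl
offset-next {zero}        {suc (suc _)} ()
offset-next {suc zero}    {zero}        ()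
offset-next {suc (suc _)} {zero}        ()
offset-next {suc a}       {suc c}       e = cong suc (offset-next e)

offset-prev : ∀ {a c} → offset a c ≡ prev → a ≡ suc c
offset-prev {zero}        {zero}        ()
offset-prev {zero}        {suc zero}    ()
offset-prev {zero}        {suc (suc _)} ()
offset-prev {suc zero}    {zero}        _ = refl
offset-prev {suc (suc _)} {zero}        ()
offset-prev {suc a}       {suc c}       e = cong suc (offset-prev e)

offset-refl : ∀ a → offset a a ≡ same
offset-refl zero    = refl
offset-refl (suc a) = offset-refl a

offset-suc : ∀ a → offset a (suc a) ≡ next
offset-suc zero    = refl
offset-suc (suc a) = offset-suc a

offset-pred : ∀ c → offset (suc c) c ≡ prev
offset-pred zero    = refl
offset-pred (suc c) = offset-pred c

reverse : Offset → Offset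
reverse same = same
reverse next = prev
reverse prev = next
reverse far  = far

offset-reverse : ∀ a c → offset c a ≡ reverse (offset a c)
offset-reverse zero          zero          = refl
offset-reverse zero          (suc zero)    = refl
offset-reverse zero          (suc (suc _)) = refl
offset-reverse (suc zero)    zero          = refl
offset-reverse (suc (suc _)) zero          = refl
offset-reverse (suc a)       (suc c)       = offset-reverse a c

isSame isNext isPrev : Offset → ℕ
isSame same = 1
isSame _    = 0
isNext next = 1
isNext _    = 0
isPrev prev = 1
isPrev _    = 0

neighbourOffsets : Offset → Offset → Bool
neighbourOffsets same next = true
neighbourOffsets same prev = true
neighbourOffsets next same = true
neighbourOffsets prev same = true
neighbourOffsets next prev = true
neighbourOffsets prev next = true
neighbourOffsets _    _    = false

-- Of the six up-tiles touching (a , b), the forward ones are (a , b + 1), (a + 1 , b), (a + 1 , b − 1).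
forward : Offset → Offset → ℕ
forward x y = isSame x * isNext y + isNext x * isSame y + isNext x * isPrev y

𝟙-neighbourOffsets : ∀ x y → 𝟙 (neighbourOffsets x y) ≡ forward x y + forward (reverse x) (reverse y)
𝟙-neighbourOffsets same same = refl
𝟙-neighbourOffsets same next = refl
𝟙-neighbourOffsets same prev = refl
𝟙-neighbourOffsets same far  = refl
𝟙-neighbourOffsets next same = refl
𝟙-neighbourOffsets next next = refl
𝟙-neighbourOffsets next prev = refl
𝟙-neighbourOffsets next far  = refl
𝟙-neighbourOffsets prev same = refl
𝟙-neighbourOffsets prev next = refl
𝟙-neighbourOffsets prev prev = refl
𝟙-neighbourOffsets prev far  = refl
𝟙-neighbourOffsets far  same = refl
𝟙-neighbourOffsets far  next = refl
𝟙-neighbourOffsets far  prev = refl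
𝟙-neighbourOffsets far  far  = refl

nodeNeighbours⇒offsets : ∀ a b c d → NodeNeighbours (a , b) (c , d) →
                         T (neighbourOffsets (offset a c) (offset b d))
nodeNeighbours⇒offsets a b c d (s≢t , _ , here refl , here refl) = ⊥-elim (s≢t refl)
nodeNeighbours⇒offsets a b c d (_ , _ , here refl , there (here refl))
  rewrite offset-pred c | offset-refl b = _
nodeNeighbours⇒offsets a b c d (_ , _ , here refl , there (there (here refl)))
  rewrite offset-refl a | offset-pred d = _
nodeNeighbours⇒offsets a b c d (_ , _ , there (here refl) , here refl)
  rewrite offset-suc a | offset-refl b = _
nodeNeighbours⇒offsets a b c d (s≢t , _ , there (here refl) , there (here refl)) = ⊥-elim (s≢t refl)
nodeNeighbours⇒offsets a b c d (_ , _ , there (here refl) , there (there (here refl)))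
  rewrite offset-suc a | offset-pred d = _
nodeNeighbours⇒offsets a b c d (_ , _ , there (there (here refl)) , here refl)
  rewrite offset-refl a | offset-suc b = _
nodeNeighbours⇒offsets a b c d (_ , _ , there (there (here refl)) , there (here refl))
  rewrite offset-pred c | offset-suc b = _
nodeNeighbours⇒offsets a b c d (s≢t , _ , there (there (here refl)) , there (there (here refl))) =
  ⊥-elim (s≢t refl)

offsets⇒nodeNeighbours : ∀ a b c d → T (neighbourOffsets (offset a c) (offset b d)) →
                         NodeNeighbours (a , b) (c , d)
offsets⇒nodeNeighbours a b c d adj with offset a c in ac | offset b d in bd
... | same | next with refl ← offset-same {a} {c} ac | refl ← offset-next {b} {d} bd =
  (λ ()) , _ , there (there (here refl)) , here refl
... | same | prev with refl ← offset-same {a} {c} ac | refl ← offset-prev {b} {d} bd =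
  (λ ()) , _ , here refl , there (there (here refl))
... | next | same with refl ← offset-next {a} {c} ac | refl ← offset-same {b} {d} bd =
  (λ ()) , _ , there (here refl) , here refl
... | prev | same with refl ← offset-prev {a} {c} ac | refl ← offset-same {b} {d} bd =
  (λ ()) , _ , here refl , there (here refl)
... | next | prev with refl ← offset-next {a} {c} ac | refl ← offset-prev {b} {d} bd =
  (λ ()) , _ , there (here refl) , there (there (here refl))
... | prev | next with refl ← offset-prev {a} {c} ac | refl ← offset-next {b} {d} bd =
  (λ ()) , _ , there (there (here refl)) , there (here refl)

adjacent : Tile → Tile → Bool
adjacent s t = does (nodeNeighbours? s t)

adjacent-sym : ∀ s t → adjacent s t ≡ adjacent t s
adjacent-sym s t = does-⇔ (mk⇔ flip flip) (nodeNeighbours? s t) (nodeNeighbours? t s)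
  where
  flip : ∀ {s t} → NodeNeighbours s t → NodeNeighbours t s
  flip (s≢t , p , p∈s , p∈t) = s≢t ∘ sym , p , p∈t , p∈s

adjacent-irrefl : ∀ s → adjacent s s ≡ false
adjacent-irrefl s = dec-false (nodeNeighbours? s s) λ (s≢s , _) → s≢s refl

𝟙-adjacent : ∀ a b c d →
  𝟙 (adjacent (a , b) (c , d)) ≡ forward (offset a c) (offset b d) + forward (offset c a) (offset d b)
𝟙-adjacent a b c d = begin
  𝟙 (adjacent (a , b) (c , d))
    ≡⟨ cong 𝟙 (does-⇔ (mk⇔ (nodeNeighbours⇒offsets a b c d) (offsets⇒nodeNeighbours a b c d))
                      (nodeNeighbours? (a , b) (c , d)) (T? _)) ⟩
  𝟙 (neighbourOffsets (offset a c) (offset b d))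
    ≡⟨ 𝟙-neighbourOffsets (offset a c) (offset b d) ⟩
  forward (offset a c) (offset b d) + forward (reverse (offset a c)) (reverse (offset b d))
    ≡⟨ cong₂ (λ x y → forward (offset a c) (offset b d) + forward x y) (offset-reverse a c) (offset-reverse b d) ⟨
  forward (offset a c) (offset b d) + forward (offset c a) (offset d b)
    ∎
  where open ≡-Reasoning

∑-isSame : ∀ N a (f : ℕ → ℕ) → (∀ i → N ≤ i → f i ≡ 0) → ∑[ c < N ] (isSame (offset a c) * f c) ≡ f a
∑-isSame N a f = ∑-select N a (isSame ∘ offset a) f (cong isSame (offset-refl a)) off
  where
  off : ∀ c → c ≢ a → isSame (offset a c) ≡ 0
  off c c≢a with offset a c in ac
  ... | same = ⊥-elim (c≢a (offset-same {a} {c} ac))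
  ... | next = refl
  ... | prev = refl
  ... | far  = refl

∑-isNext : ∀ N a (f : ℕ → ℕ) → (∀ i → N ≤ i → f i ≡ 0) → ∑[ c < N ] (isNext (offset a c) * f c) ≡ f (suc a)
∑-isNext N a f = ∑-select N (suc a) (isNext ∘ offset a) f (cong isNext (offset-suc a)) off
  where
  off : ∀ c → c ≢ suc a → isNext (offset a c) ≡ 0
  off c c≢1+a with offset a c in ac
  ... | same = refl
  ... | next = ⊥-elim (c≢1+a (offset-next {a} {c} ac))
  ... | prev = refl
  ... | far  = refl

∑-isPrev : ∀ N d (f : ℕ → ℕ) → (∀ i → N ≤ i → f i ≡ 0) → ∑[ b < N ] (isPrev (offset b d) * f b) ≡ f (suc d)
∑-isPrev N d f = ∑-select N (suc d) (λ b → isPrev (offset b d)) f (cong isPrev (offset-pred d)) off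
  where
  off : ∀ b → b ≢ suc d → isPrev (offset b d) ≡ 0
  off b b≢1+d with offset b d in bd
  ... | same = refl
  ... | next = refl
  ... | prev = ⊥-elim (b≢1+d (offset-prev {b} {d} bd))
  ... | far  = refl

-- Counting the tiles and edges of a pattern

Pattern : Set
Pattern = ℕ → ℕ → Bool

InTriangle : ℕ → Pattern → Set
InTriangle N P = ∀ a b → P a b ≡ true → a + b < N

darkTiles : ℕ → Pattern → List Tile
darkTiles N P = filter (T? ∘ uncurry P) (grid N)

bStepPair aStepPair skewPair : Pattern → ℕ → ℕ → ℕ
bStepPair P a b = 𝟙 (P a b) * 𝟙 (P a (suc b))
aStepPair   P a b = 𝟙 (P a b) * 𝟙 (P (suc a) b)
skewPair   P a b = 𝟙 (P a (suc b)) * 𝟙 (P (suc a) b)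

darkCount bStepCount aStepCount skewCount : ℕ → Pattern → ℕ
darkCount       N P = ∑[ a < N ] ∑[ b < N ] 𝟙 (P a b)
bStepCount N P = ∑[ a < N ] ∑[ b < N ] bStepPair P a b
aStepCount   N P = ∑[ a < N ] ∑[ b < N ] aStepPair P a b
skewCount   N P = ∑[ a < N ] ∑[ b < N ] skewPair P a b

𝟙-outside : ∀ {N P} → InTriangle N P → ∀ a b → N ≤ a + b → 𝟙 (P a b) ≡ 0
𝟙-outside {P = P} inside a b N≤a+b with P a b in Pab
... | false = refl
... | true  = ⊥-elim (<⇒≱ (inside a b Pab) N≤a+b)

length-darkTiles : ∀ N P → length (darkTiles N P) ≡ darkCount N P
length-darkTiles N P = trans (length-filter (T? ∘ uncurry P) (grid N)) (sumMap-grid (𝟙 ∘ uncurry P) N)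

aStepCount≡bStepCount : ∀ N P → (∀ a b → P a b ≡ P b a) → aStepCount N P ≡ bStepCount N P
aStepCount≡bStepCount N P P-sym = trans
  (∑-cong N λ a → ∑-cong N λ b → cong₂ (λ x y → 𝟙 x * 𝟙 y) (P-sym a b) (P-sym (suc a) b))
  (∑-comm N N λ a b → bStepPair P b a)

module EdgeCount (N : ℕ) (P : Pattern) (inside : InTriangle N P) where

  private
    p : ℕ → ℕ → ℕ
    p a b = 𝟙 (P a b)

    p-outˡ : ∀ a b → N ≤ a → p a b ≡ 0
    p-outˡ a b N≤a = 𝟙-outside inside a b (≤-trans N≤a (m≤m+n a b))

    p-outʳ : ∀ a b → N ≤ b → p a b ≡ 0
    p-outʳ a b N≤b = 𝟙-outside inside a b (≤-trans N≤b (m≤n+m b a))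

    ∑⁴ : (ℕ → ℕ → ℕ → ℕ → ℕ) → ℕ
    ∑⁴ F = ∑[ a < N ] ∑[ b < N ] ∑[ c < N ] ∑[ d < N ] F a b c d

    ∑⁴-cong : ∀ {F G} → (∀ a b c d → F a b c d ≡ G a b c d) → ∑⁴ F ≡ ∑⁴ G
    ∑⁴-cong F≡G = ∑-cong N λ a → ∑-cong N λ b → ∑-cong N λ c → ∑-cong N λ d → F≡G a b c d

    ∑⁴-+ : ∀ F G → ∑⁴ (λ a b c d → F a b c d + G a b c d) ≡ ∑⁴ F + ∑⁴ G
    ∑⁴-+ F G = trans (∑-cong N λ a → trans (∑-cong N λ b → trans (∑-cong N λ c → ∑-+ N (F a b c) (G a b c))
                                                                  (∑-+ N _ _))
                                            (∑-+ N _ _))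
                     (∑-+ N _ _)

    ∑⁴-swap : ∀ F → ∑⁴ (λ a b c d → F c d a b) ≡ ∑⁴ F
    ∑⁴-swap F = begin
      ∑[ a < N ] ∑[ b < N ] ∑[ c < N ] ∑[ d < N ] F c d a b
        ≡⟨ ∑-cong N (λ a → ∑-comm N N λ b c → ∑[ d < N ] F c d a b) ⟩
      ∑[ a < N ] ∑[ c < N ] ∑[ b < N ] ∑[ d < N ] F c d a b
        ≡⟨ ∑-comm N N _ ⟩
      ∑[ c < N ] ∑[ a < N ] ∑[ b < N ] ∑[ d < N ] F c d a b
        ≡⟨ ∑-cong N (λ c → ∑-cong N λ a → ∑-comm N N λ b d → F c d a b) ⟩
      ∑[ c < N ] ∑[ a < N ] ∑[ d < N ] ∑[ b < N ] F c d a b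
        ≡⟨ ∑-cong N (λ c → ∑-comm N N λ a d → ∑[ b < N ] F c d a b) ⟩
      ∑[ c < N ] ∑[ d < N ] ∑[ a < N ] ∑[ b < N ] F c d a b ∎
      where open ≡-Reasoning

    X bTerm aTerm skewTerm : ℕ → ℕ → ℕ → ℕ → ℕ
    X        a b c d = p a b * (p c d * forward (offset a c) (offset b d))
    bTerm    a b c d = p a b * (isSame (offset a c) * (isNext (offset b d) * p c d))
    aTerm    a b c d = p a b * (isNext (offset a c) * (isSame (offset b d) * p c d))
    skewTerm a b c d = isNext (offset a c) * (isPrev (offset b d) * (p a b * p c d))

    ∑⁴-bTerm : ∑⁴ bTerm ≡ bStepCount N P
    ∑⁴-bTerm = ∑-cong N λ a → ∑-cong N λ b → begin
      ∑[ c < N ] ∑[ d < N ] (p a b * (isSame (offset a c) * (isNext (offset b d) * p c d)))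
        ≡⟨ ∑∑-*ˡ N N (p a b) _ ⟩
      p a b * ∑[ c < N ] ∑[ d < N ] (isSame (offset a c) * (isNext (offset b d) * p c d))
        ≡⟨ cong (p a b *_) (∑-cong N λ c → ∑-*ˡ N (isSame (offset a c)) _) ⟩
      p a b * ∑[ c < N ] (isSame (offset a c) * ∑[ d < N ] (isNext (offset b d) * p c d))
        ≡⟨ cong (p a b *_) (∑-cong N λ c → cong (isSame (offset a c) *_) (∑-isNext N b (p c) (p-outʳ c))) ⟩
      p a b * ∑[ c < N ] (isSame (offset a c) * p c (suc b))
        ≡⟨ cong (p a b *_) (∑-isSame N a (λ c → p c (suc b)) λ c → p-outˡ c (suc b)) ⟩
      p a b * p a (suc b) ∎
      where open ≡-Reasoning

    ∑⁴-aTerm : ∑⁴ aTerm ≡ aStepCount N P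
    ∑⁴-aTerm = ∑-cong N λ a → ∑-cong N λ b → begin
      ∑[ c < N ] ∑[ d < N ] (p a b * (isNext (offset a c) * (isSame (offset b d) * p c d)))
        ≡⟨ ∑∑-*ˡ N N (p a b) _ ⟩
      p a b * ∑[ c < N ] ∑[ d < N ] (isNext (offset a c) * (isSame (offset b d) * p c d))
        ≡⟨ cong (p a b *_) (∑-cong N λ c → ∑-*ˡ N (isNext (offset a c)) _) ⟩
      p a b * ∑[ c < N ] (isNext (offset a c) * ∑[ d < N ] (isSame (offset b d) * p c d))
        ≡⟨ cong (p a b *_) (∑-cong N λ c → cong (isNext (offset a c) *_) (∑-isSame N b (p c) (p-outʳ c))) ⟩
      p a b * ∑[ c < N ] (isNext (offset a c) * p c b)
        ≡⟨ cong (p a b *_) (∑-isNext N a (λ c → p c b) λ c → p-outˡ c b) ⟩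
      p a b * p (suc a) b ∎
      where open ≡-Reasoning

    ∑⁴-skewTerm : ∑⁴ skewTerm ≡ skewCount N P
    ∑⁴-skewTerm = ∑-cong N λ a → begin
      ∑[ b < N ] ∑[ c < N ] ∑[ d < N ] (isNext (offset a c) * (isPrev (offset b d) * (p a b * p c d)))
        ≡⟨ ∑-comm N N _ ⟩
      ∑[ c < N ] ∑[ b < N ] ∑[ d < N ] (isNext (offset a c) * (isPrev (offset b d) * (p a b * p c d)))
        ≡⟨ ∑-cong N (λ c → ∑-comm N N _) ⟩
      ∑[ c < N ] ∑[ d < N ] ∑[ b < N ] (isNext (offset a c) * (isPrev (offset b d) * (p a b * p c d)))
        ≡⟨ ∑-cong N (λ c → ∑-cong N λ d → ∑-*ˡ N (isNext (offset a c)) _) ⟩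
      ∑[ c < N ] ∑[ d < N ] (isNext (offset a c) * ∑[ b < N ] (isPrev (offset b d) * (p a b * p c d)))
        ≡⟨ ∑-cong N (λ c → ∑-cong N λ d → cong (isNext (offset a c) *_)
                              (∑-isPrev N d (λ b → p a b * p c d) λ b N≤b → cong (_* p c d) (p-outʳ a b N≤b))) ⟩
      ∑[ c < N ] ∑[ d < N ] (isNext (offset a c) * (p a (suc d) * p c d))
        ≡⟨ ∑-cong N (λ c → ∑-*ˡ N (isNext (offset a c)) _) ⟩
      ∑[ c < N ] (isNext (offset a c) * ∑[ d < N ] (p a (suc d) * p c d))
        ≡⟨ ∑-isNext N a _ (λ c N≤c → ∑-≡0 N λ d _ →
             trans (cong (p a (suc d) *_) (p-outˡ c d N≤c)) (*-zeroʳ (p a (suc d)))) ⟩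
      ∑[ d < N ] (p a (suc d) * p (suc a) d) ∎
      where open ≡-Reasoning

    ∑⁴-forward : ∑⁴ X ≡ bStepCount N P + aStepCount N P + skewCount N P
    ∑⁴-forward = begin
      ∑⁴ X
        ≡⟨ ∑⁴-cong (λ a b c d → expand (p a b) (p c d) (isSame (offset a c)) (isNext (offset a c))
                                       (isNext (offset b d)) (isSame (offset b d)) (isPrev (offset b d))) ⟩
      ∑⁴ (λ a b c d → bTerm a b c d + aTerm a b c d + skewTerm a b c d)
        ≡⟨ trans (∑⁴-+ _ skewTerm) (cong (_+ ∑⁴ skewTerm) (∑⁴-+ bTerm aTerm)) ⟩
      ∑⁴ bTerm + ∑⁴ aTerm + ∑⁴ skewTerm
        ≡⟨ cong₂ _+_ (cong₂ _+_ ∑⁴-bTerm ∑⁴-aTerm) ∑⁴-skewTerm ⟩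
      bStepCount N P + aStepCount N P + skewCount N P ∎
      where
      open ≡-Reasoning
      expand : ∀ x y s₁ n₁ n₂ s₂ p₂ → x * (y * (s₁ * n₂ + n₁ * s₂ + n₁ * p₂)) ≡
                                      x * (s₁ * (n₂ * y)) + x * (n₁ * (s₂ * y)) + n₁ * (p₂ * (x * y))
      expand = solve-∀

    w : Tile → Tile → ℕ
    w s t = 𝟙 (uncurry P s) * (𝟙 (uncurry P t) * 𝟙 (adjacent s t))

    w-sym : ∀ s t → w s t ≡ w t s
    w-sym s t = trans (exchange (𝟙 (uncurry P s)) (𝟙 (uncurry P t)) (𝟙 (adjacent s t)))
                      (cong (λ z → 𝟙 (uncurry P t) * (𝟙 (uncurry P s) * 𝟙 z)) (adjacent-sym s t))
      where
      exchange : ∀ x y z → x * (y * z) ≡ y * (x * z)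
      exchange = solve-∀

    w-diag : ∀ s → w s s ≡ 0
    w-diag s rewrite adjacent-irrefl s = trans (cong (x *_) (*-zeroʳ x)) (*-zeroʳ x)
      where x = 𝟙 (uncurry P s)

    w-offsets : ∀ a b c d → w (a , b) (c , d) ≡ X a b c d + X c d a b
    w-offsets a b c d = trans (cong (λ z → p a b * (p c d * z)) (𝟙-adjacent a b c d))
                              (distrib (p a b) (p c d) _ _)
      where
      distrib : ∀ x y u v → x * (y * (u + v)) ≡ x * (y * u) + y * (x * v)
      distrib = solve-∀

  -- Over ordered pairs every edge is counted once from each end, and exactly one of the two
  -- orientations is forward.
  length-adjacentPairs :
    length (filter (λ e → nodeNeighbours? (proj₁ e) (proj₂ e)) (pairs (darkTiles N P))) ≡
    bStepCount N P + aStepCount N P + skewCount N P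
  length-adjacentPairs = *-cancelˡ-≡ _ _ 2 (begin
    2 * length (filter (λ e → nodeNeighbours? (proj₁ e) (proj₂ e)) (pairs (darkTiles N P)))
      ≡⟨ cong (2 *_) (length-filter (λ e → nodeNeighbours? (proj₁ e) (proj₂ e)) (pairs (darkTiles N P))) ⟩
    2 * sumMap (uncurry λ s t → 𝟙 (adjacent s t)) (pairs (darkTiles N P))
      ≡⟨ cong (2 *_) (sumMap-pairs-filter (uncurry P) (λ s t → 𝟙 (adjacent s t)) (grid N)) ⟩
    2 * sumMap (uncurry w) (pairs (grid N))
      ≡⟨ sumMap-pairs-double w w-sym w-diag (grid N) ⟩
    sumMap (λ s → sumMap (w s) (grid N)) (grid N)
      ≡⟨ trans (sumMap-grid _ N) (∑-cong N λ a → ∑-cong N λ b → sumMap-grid (w (a , b)) N) ⟩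
    ∑⁴ (λ a b c d → w (a , b) (c , d))
      ≡⟨ trans (∑⁴-cong w-offsets) (∑⁴-+ X λ a b c d → X c d a b) ⟩
    ∑⁴ X + ∑⁴ (λ a b c d → X c d a b)
      ≡⟨ cong (λ z → ∑⁴ X + z) (trans (∑⁴-swap X) (sym (+-identityʳ _))) ⟩
    2 * ∑⁴ X
      ≡⟨ cong (2 *_) ∑⁴-forward ⟩
    2 * (bStepCount N P + aStepCount N P + skewCount N P) ∎)
    where open ≡-Reasoning

Tri-suc : ∀ n → Tri (suc n) ≡ suc n + Tri n
Tri-suc n = begin
  suc n * suc (suc n) / 2        ≡⟨ cong (_/ 2) (expand n) ⟩
  (suc n * 2 + n * suc n) / 2    ≡⟨ +-distrib-/-∣ˡ (n * suc n) (n∣m*n (suc n)) ⟩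
  suc n * 2 / 2 + n * suc n / 2  ≡⟨ cong (_+ Tri n) (m*n/n≡m (suc n) 2) ⟩
  suc n + Tri n                  ∎
  where
  open ≡-Reasoning
  expand : ∀ n → suc n * suc (suc n) ≡ suc n * 2 + n * suc n
  expand = solve-∀

∑-∸ : ∀ N L → L ≤ N → ∑[ q < N ] (L ∸ q) ≡ Tri L
∑-∸ N       zero    _         = ∑-≡0 N λ q _ → 0∸n≡0 q
∑-∸ (suc N) (suc L) (s≤s L≤N) = trans (cong (suc L +_) (∑-∸ N L L≤N)) (sym (Tri-suc L))

-- suc x ≤ᵇ L unfolds to x <ᵇ L, which is stuck unless x is a constructor; hence the deeper split.
𝟙-≤ᵇ-suc : ∀ x L → 𝟙 (x ≤ᵇ L) + (L ∸ x) ≡ suc L ∸ x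
𝟙-≤ᵇ-suc zero          L       = refl
𝟙-≤ᵇ-suc (suc zero)    zero    = refl
𝟙-≤ᵇ-suc (suc (suc x)) zero    = refl
𝟙-≤ᵇ-suc (suc zero)    (suc L) = refl
𝟙-≤ᵇ-suc (suc (suc x)) (suc L) = 𝟙-≤ᵇ-suc (suc x) L

∑-≤ᵇ : ∀ N x L → suc L ≤ N + x → ∑[ p < N ] 𝟙 (x + p ≤ᵇ L) ≡ suc L ∸ x
∑-≤ᵇ zero    x L 1+L≤x   = sym (m≤n⇒m∸n≡0 1+L≤x)
∑-≤ᵇ (suc N) x L 1+L≤N+x = begin
  𝟙 (x + 0 ≤ᵇ L) + ∑[ p < N ] 𝟙 (x + suc p ≤ᵇ L)
    ≡⟨ cong₂ _+_ (cong (λ y → 𝟙 (y ≤ᵇ L)) (+-identityʳ x))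
                 (∑-cong N λ p → cong (λ y → 𝟙 (y ≤ᵇ L)) (+-suc x p)) ⟩
  𝟙 (x ≤ᵇ L) + ∑[ p < N ] 𝟙 (suc x + p ≤ᵇ L)
    ≡⟨ cong (𝟙 (x ≤ᵇ L) +_) (∑-≤ᵇ N (suc x) L (subst (suc L ≤_) (sym (+-suc N x)) 1+L≤N+x)) ⟩
  𝟙 (x ≤ᵇ L) + (L ∸ x)
    ≡⟨ 𝟙-≤ᵇ-suc x L ⟩
  suc L ∸ x ∎
  where open ≡-Reasoning

module _ (n' : ℕ) where

  private
    n = suc n'

  darkCount-darkGen : darkCount n (darkGen n) ≡ Tri n
  darkCount-darkGen = trans (∑-cong n λ q → ∑-≤ᵇ n q n' (s≤s (m≤m+n n' q))) (∑-∸ n n ≤-refl)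

  private
    shiftedCount : ∑[ q < n ] ∑[ p < n ] 𝟙 (suc q + p ≤ᵇ n') ≡ Tri n'
    shiftedCount = trans (∑-cong n λ q → ∑-≤ᵇ n (suc q) n' (m≤m+n n (suc q)))
                         (∑-∸ n n' (n≤1+n n'))

  bStepCount-darkGen : bStepCount n (darkGen n) ≡ Tri n'
  bStepCount-darkGen = trans (∑-cong n λ q → ∑-cong n λ p → begin
    𝟙 (q + p ≤ᵇ n') * 𝟙 (q + suc p ≤ᵇ n')   ≡⟨ cong (λ y → 𝟙 (q + p ≤ᵇ n') * 𝟙 (y ≤ᵇ n')) (+-suc q p) ⟩
    𝟙 (q + p ≤ᵇ n') * 𝟙 (suc q + p ≤ᵇ n')   ≡⟨ 𝟙-implied (λ t → ≤⇒≤ᵇ (<⇒≤ (≤ᵇ⇒≤ (suc q + p) n' t))) ⟩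
    𝟙 (suc q + p ≤ᵇ n')                     ∎) shiftedCount
    where open ≡-Reasoning

  skewCount-darkGen : skewCount n (darkGen n) ≡ Tri n'
  skewCount-darkGen = trans (∑-cong n λ q → ∑-cong n λ p →
    trans (cong (λ y → 𝟙 (y ≤ᵇ n') * 𝟙 (suc q + p ≤ᵇ n')) (+-suc q p)) (𝟙-idem (suc q + p ≤ᵇ n')))
    shiftedCount

-- Substituting a pattern into the generator

[q*m+r]/m≡q : ∀ q r m .{{_ : NonZero m}} → r < m → (q * m + r) / m ≡ q
[q*m+r]/m≡q q r m r<m = begin
  (q * m + r) / m      ≡⟨ +-distrib-/-∣ˡ r (n∣m*n q) ⟩
  q * m / m + r / m    ≡⟨ cong₂ _+_ (m*n/n≡m q m) (m<n⇒m/n≡0 r<m) ⟩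
  q + 0                ≡⟨ +-identityʳ q ⟩
  q                    ∎
  where open ≡-Reasoning

[q*m+r]%m≡r : ∀ q r m .{{_ : NonZero m}} → r < m → (q * m + r) % m ≡ r
[q*m+r]%m≡r q r m r<m = trans (cong (_% m) (+-comm (q * m) r)) (trans ([m+kn]%n≡m%n r q m) (m<n⇒m%n≡m r<m))

substitute : (n m : ℕ) .{{_ : NonZero m}} → Pattern → Pattern
substitute n m P a b = darkGen n (a / m) (b / m) ∧ P (a % m) (b % m)

substitute-block : ∀ n m .{{_ : NonZero m}} P q r p s → r < m → s < m →
                   substitute n m P (q * m + r) (p * m + s) ≡ darkGen n q p ∧ P r s
substitute-block n m P q r p s r<m s<m =
  cong₂ _∧_ (cong₂ (darkGen n) ([q*m+r]/m≡q q r m r<m) ([q*m+r]/m≡q p s m s<m))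
            (cong₂ P ([q*m+r]%m≡r q r m r<m) ([q*m+r]%m≡r p s m s<m))

-- Across neighbouring blocks only corner tiles touch: (r , m − 1) and (r , 0) for b-steps, which
-- for a pattern in the triangle forces r = 0, and (m − 1 , 0) with (0 , m − 1) for skew steps.
module Substitution (n' m' : ℕ) (P : Pattern) where

  private
    n m : ℕ
    n = suc n'
    m = suc m'

    Q : Pattern
    Q = substitute n m P

    G : Pattern
    G = darkGen n

    g : ℕ → ℕ → ℕ
    g q p = 𝟙 (G q p)

    block : ∀ q r p s → r < m → s < m → Q (q * m + r) (p * m + s) ≡ G q p ∧ P r s
    block = substitute-block n m P

    m≤m′+1+s : ∀ s → m ≤ m' + suc s
    m≤m′+1+s s = subst (m ≤_) (sym (+-suc m' s)) (s≤s (m≤m+n m' s))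

    nextBlock : ∀ p → suc (p * m + m') ≡ suc p * m + 0
    nextBlock p = trans (cong suc (+-comm (p * m) m')) (sym (+-identityʳ _))

    ∑∑-blocks : ∀ (F : ℕ → ℕ → ℕ) → ∑[ a < n * m ] ∑[ b < n * m ] F a b ≡
                ∑[ q < n ] ∑[ r < m ] ∑[ p < n ] ∑[ s < m ] F (q * m + r) (p * m + s)
    ∑∑-blocks F = trans (∑-blocks n m λ a → ∑[ b < n * m ] F a b)
                        (∑-cong n λ q → ∑-cong m λ r → ∑-blocks n m (F (q * m + r)))

  darkCount-substitute : darkCount (n * m) Q ≡ Tri n * darkCount m P
  darkCount-substitute = begin
    darkCount (n * m) Q
      ≡⟨ ∑∑-blocks (λ a b → 𝟙 (Q a b)) ⟩
    ∑[ q < n ] ∑[ r < m ] ∑[ p < n ] ∑[ s < m ] 𝟙 (Q (q * m + r) (p * m + s))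
      ≡⟨ ∑-cong n (λ q → ∑-cong< m λ r r<m → ∑-cong n λ p → ∑-cong< m λ s s<m →
           trans (cong 𝟙 (block q r p s r<m s<m)) (𝟙-∧ (darkGen n q p) (P r s))) ⟩
    ∑[ q < n ] ∑[ r < m ] ∑[ p < n ] ∑[ s < m ] (g q p * 𝟙 (P r s))
      ≡⟨ ∑⁴-separate n m g (λ r s → 𝟙 (P r s)) ⟩
    darkCount n (darkGen n) * darkCount m P
      ≡⟨ cong (_* darkCount m P) (darkCount-darkGen n') ⟩
    Tri n * darkCount m P ∎
    where open ≡-Reasoning

  module _ (inside : InTriangle m P) where

    private
      𝟙-outside′ : ∀ a b → m ≤ a + b → 𝟙 (P a b) ≡ 0
      𝟙-outside′ = 𝟙-outside inside

      𝟙Q-outside : ∀ q r p s → r < m → s < m → m ≤ r + s → 𝟙 (Q (q * m + r) (p * m + s)) ≡ 0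
      𝟙Q-outside q r p s r<m s<m m≤r+s = begin
        𝟙 (Q (q * m + r) (p * m + s))  ≡⟨ cong 𝟙 (block q r p s r<m s<m) ⟩
        𝟙 (G q p ∧ P r s)              ≡⟨ 𝟙-∧ (G q p) (P r s) ⟩
        g q p * 𝟙 (P r s)              ≡⟨ cong (g q p *_) (𝟙-outside′ r s m≤r+s) ⟩
        g q p * 0                      ≡⟨ *-zeroʳ (g q p) ⟩
        0                              ∎
        where open ≡-Reasoning

    bStepCount-substitute : P 0 0 ≡ true → P 0 m' ≡ true →
                                 bStepCount (n * m) Q ≡ Tri n * bStepCount m P + Tri n'
    bStepCount-substitute P00 P0m′ = begin
      bStepCount (n * m) Q
        ≡⟨ ∑∑-blocks (bStepPair Q) ⟩
      ∑[ q < n ] ∑[ r < m ] ∑[ p < n ] ∑[ s < m ] bStepPair Q (q * m + r) (p * m + s)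
        ≡⟨ ∑-cong n (λ q → ∑-cong< m λ r r<m → ∑-cong n λ p → blockRow q r p r<m) ⟩
      ∑[ q < n ] ∑[ r < m ] ∑[ p < n ] (g q p * Δ r + bStepPair G q p * ε r)
        ≡⟨ ∑³-+ n m n (λ q r p → g q p * Δ r) (λ q r p → bStepPair G q p * ε r) ⟩
      ∑[ q < n ] ∑[ r < m ] ∑[ p < n ] (g q p * Δ r) + ∑[ q < n ] ∑[ r < m ] ∑[ p < n ] (bStepPair G q p * ε r)
        ≡⟨ cong₂ _+_ (∑³-separate n m g Δ) (∑³-separate n m (bStepPair G) ε) ⟩
      darkCount n G * ∑[ r < m ] Δ r + bStepCount n G * ∑[ r < m ] ε r
        ≡⟨ cong₂ _+_ (cong₂ _*_ (darkCount-darkGen n') (sym ∑-Δ)) (cong₂ _*_ (bStepCount-darkGen n') ∑-ε) ⟩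
      Tri n * bStepCount m P + Tri n' * 1
        ≡⟨ cong (Tri n * bStepCount m P +_) (*-identityʳ (Tri n')) ⟩
      Tri n * bStepCount m P + Tri n' ∎
      where
      open ≡-Reasoning

      Δ ε : ℕ → ℕ
      Δ r = ∑[ s < m' ] bStepPair P r s
      ε r = 𝟙 (P r m') * 𝟙 (P r 0)

      blockRow : ∀ q r p → r < m →
                 ∑[ s < m ] bStepPair Q (q * m + r) (p * m + s) ≡ g q p * Δ r + bStepPair G q p * ε r
      blockRow q r p r<m = trans (∑-last m' _) (cong₂ _+_ interior boundary)
        where
        interior : ∑[ s < m' ] bStepPair Q (q * m + r) (p * m + s) ≡ g q p * Δ r
        interior = trans (∑-cong< m' λ s s<m' →
            trans (cong₂ (λ x y → 𝟙 x * 𝟙 y) (block q r p s r<m (m≤n⇒m≤1+n s<m'))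
                         (trans (cong (Q (q * m + r)) (sym (+-suc (p * m) s))) (block q r p (suc s) r<m (s≤s s<m'))))
                  (𝟙-∧-shared (G q p) (P r s) (P r (suc s))))
          (∑-*ˡ m' (g q p) (bStepPair P r))
        boundary : bStepPair Q (q * m + r) (p * m + m') ≡ bStepPair G q p * ε r
        boundary = trans (cong₂ (λ x y → 𝟙 x * 𝟙 y) (block q r p m' r<m ≤-refl)
                                (trans (cong (Q (q * m + r)) (nextBlock p)) (block q r (suc p) 0 r<m (s≤s z≤n))))
                         (𝟙-∧-interchange (G q p) (P r m') (G q (suc p)) (P r 0))

      ∑-Δ : bStepCount m P ≡ ∑[ r < m ] Δ r
      ∑-Δ = ∑-cong m λ r → begin
        ∑[ s < m ] bStepPair P r s              ≡⟨ ∑-last m' (bStepPair P r) ⟩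
        Δ r + 𝟙 (P r m') * 𝟙 (P r m)                ≡⟨ cong (λ z → Δ r + 𝟙 (P r m') * z) (𝟙-outside′ r m (m≤n+m m r)) ⟩
        Δ r + 𝟙 (P r m') * 0                        ≡⟨ cong (Δ r +_) (*-zeroʳ (𝟙 (P r m'))) ⟩
        Δ r + 0                                     ≡⟨ +-identityʳ (Δ r) ⟩
        Δ r                                         ∎

      ∑-ε : ∑[ r < m ] ε r ≡ 1
      ∑-ε = trans (∑-single m 0 ε off out) (cong₂ (λ x y → 𝟙 x * 𝟙 y) P0m′ P00)
        where
        off : ∀ r → r ≢ 0 → ε r ≡ 0
        off zero    0≢0 = ⊥-elim (0≢0 refl)
        off (suc r) _   = cong (_* 𝟙 (P (suc r) 0)) (𝟙-outside′ (suc r) m' (s≤s (m≤n+m m' r)))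
        out : ∀ r → m ≤ r → ε r ≡ 0
        out r m≤r = cong (_* 𝟙 (P r 0)) (𝟙-outside′ r m' (≤-trans m≤r (m≤m+n r m')))

    skewCount-substitute : P 0 m' ≡ true → P m' 0 ≡ true →
                               skewCount (n * m) Q ≡ Tri n * skewCount m P + Tri n'
    skewCount-substitute P0m′ Pm′0 = begin
      skewCount (n * m) Q
        ≡⟨ ∑∑-blocks (skewPair Q) ⟩
      ∑[ q < n ] ∑[ r < m ] ∑[ p < n ] ∑[ s < m ] skewPair Q (q * m + r) (p * m + s)
        ≡⟨ ∑-cong n (λ q → ∑-last m' λ r → ∑[ p < n ] ∑[ s < m ] skewPair Q (q * m + r) (p * m + s)) ⟩
      ∑[ q < n ] (∑[ r < m' ] ∑[ p < n ] ∑[ s < m ] skewPair Q (q * m + r) (p * m + s)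
                  + ∑[ p < n ] ∑[ s < m ] skewPair Q (q * m + m') (p * m + s))
        ≡⟨ ∑-cong n (λ q → cong₂ _+_ (∑-cong< m' λ r r<m' → ∑-cong n λ p → innerRow q r p r<m')
                                      (∑-cong n λ p → lastRow q p)) ⟩
      ∑[ q < n ] (∑[ r < m' ] ∑[ p < n ] (g q p * Δ r) + ∑[ p < n ] skewPair G q p)
        ≡⟨ ∑-+ n (λ q → ∑[ r < m' ] ∑[ p < n ] (g q p * Δ r)) (λ q → ∑[ p < n ] skewPair G q p) ⟩
      ∑[ q < n ] ∑[ r < m' ] ∑[ p < n ] (g q p * Δ r) + skewCount n G
        ≡⟨ cong₂ _+_ (∑³-separate n m' g Δ) (skewCount-darkGen n') ⟩
      darkCount n G * ∑[ r < m' ] Δ r + Tri n'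
        ≡⟨ cong (_+ Tri n') (cong₂ _*_ (darkCount-darkGen n') (sym ∑-Δ)) ⟩
      Tri n * skewCount m P + Tri n' ∎
      where
      open ≡-Reasoning

      Δ : ℕ → ℕ
      Δ r = ∑[ s < m' ] skewPair P r s

      interior : ∀ q r p s → suc r < m → suc s < m →
                 skewPair Q (q * m + r) (p * m + s) ≡ g q p * skewPair P r s
      interior q r p s 1+r<m 1+s<m =
        trans (cong₂ (λ x y → 𝟙 x * 𝟙 y)
                     (trans (cong (Q (q * m + r)) (sym (+-suc (p * m) s))) (block q r p (suc s) (<⇒≤ 1+r<m) 1+s<m))
                     (trans (cong (λ a → Q a (p * m + s)) (sym (+-suc (q * m) r))) (block q (suc r) p s 1+r<m (<⇒≤ 1+s<m))))
              (𝟙-∧-shared (G q p) (P r (suc s)) (P (suc r) s))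

      innerRow : ∀ q r p → r < m' → ∑[ s < m ] skewPair Q (q * m + r) (p * m + s) ≡ g q p * Δ r
      innerRow q r p r<m' = begin
        ∑[ s < m ] skewPair Q (q * m + r) (p * m + s)
          ≡⟨ ∑-last m' _ ⟩
        ∑[ s < m' ] skewPair Q (q * m + r) (p * m + s) + skewPair Q (q * m + r) (p * m + m')
          ≡⟨ cong₂ _+_ (∑-cong< m' λ s s<m' → interior q r p s (s≤s r<m') (s≤s s<m')) boundary ⟩
        ∑[ s < m' ] (g q p * skewPair P r s) + 0
          ≡⟨ trans (+-identityʳ _) (∑-*ˡ m' (g q p) (skewPair P r)) ⟩
        g q p * Δ r ∎
        where
        boundary : skewPair Q (q * m + r) (p * m + m') ≡ 0
        boundary = trans (cong (𝟙 (Q (q * m + r) (suc (p * m + m'))) *_)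
                               (trans (cong (λ a → 𝟙 (Q a (p * m + m'))) (sym (+-suc (q * m) r)))
                                      (𝟙Q-outside q (suc r) p m' (s≤s r<m') ≤-refl (s≤s (m≤n+m m' r)))))
                         (*-zeroʳ (𝟙 (Q (q * m + r) (suc (p * m + m')))))

      lastRow : ∀ q p → ∑[ s < m ] skewPair Q (q * m + m') (p * m + s) ≡ skewPair G q p
      lastRow q p = begin
        ∑[ s < m ] skewPair Q (q * m + m') (p * m + s)
          ≡⟨ ∑-last m' _ ⟩
        ∑[ s < m' ] skewPair Q (q * m + m') (p * m + s) + skewPair Q (q * m + m') (p * m + m')
          ≡⟨ cong₂ _+_ (∑-≡0 m' λ s s<m' → cong (_* 𝟙 (Q (suc (q * m + m')) (p * m + s))) (upperDark s s<m'))
                       corner ⟩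
        0 + skewPair G q p * 1
          ≡⟨ *-identityʳ _ ⟩
        skewPair G q p ∎
        where
        upperDark : ∀ s → s < m' → 𝟙 (Q (q * m + m') (suc (p * m + s))) ≡ 0
        upperDark s s<m' = trans (cong (λ b → 𝟙 (Q (q * m + m') b)) (sym (+-suc (p * m) s)))
                                 (𝟙Q-outside q m' p (suc s) ≤-refl (s≤s s<m') (m≤m′+1+s s))
        corner : skewPair Q (q * m + m') (p * m + m') ≡ skewPair G q p * 1
        corner = begin
          𝟙 (Q (q * m + m') (suc (p * m + m'))) * 𝟙 (Q (suc (q * m + m')) (p * m + m'))
            ≡⟨ cong₂ (λ x y → 𝟙 x * 𝟙 y)
                     (trans (cong (Q (q * m + m')) (nextBlock p)) (block q m' (suc p) 0 ≤-refl (s≤s z≤n)))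
                     (trans (cong (λ a → Q a (p * m + m')) (nextBlock q)) (block (suc q) 0 p m' (s≤s z≤n) ≤-refl)) ⟩
          𝟙 (G q (suc p) ∧ P m' 0) * 𝟙 (G (suc q) p ∧ P 0 m')
            ≡⟨ 𝟙-∧-interchange (G q (suc p)) (P m' 0) (G (suc q) p) (P 0 m') ⟩
          skewPair G q p * (𝟙 (P m' 0) * 𝟙 (P 0 m'))
            ≡⟨ cong₂ (λ x y → skewPair G q p * (𝟙 x * 𝟙 y)) Pm′0 P0m′ ⟩
          skewPair G q p * 1 ∎

      ∑-Δ : skewCount m P ≡ ∑[ r < m' ] Δ r
      ∑-Δ = begin
        ∑[ r < m ] ∑[ s < m ] skewPair P r s
          ≡⟨ ∑-last m' _ ⟩
        ∑[ r < m' ] ∑[ s < m ] skewPair P r s + ∑[ s < m ] skewPair P m' s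
          ≡⟨ cong₂ _+_ (∑-cong m' λ r → trans (∑-last m' _) (cong (Δ r +_) (lastColumn r))) lastRowP ⟩
        ∑[ r < m' ] (Δ r + 0) + 0
          ≡⟨ trans (+-identityʳ _) (∑-cong m' λ r → +-identityʳ (Δ r)) ⟩
        ∑[ r < m' ] Δ r ∎
        where
        lastColumn : ∀ r → skewPair P r m' ≡ 0
        lastColumn r = cong (_* 𝟙 (P (suc r) m')) (𝟙-outside′ r m (m≤n+m m r))
        lastRowP : ∑[ s < m ] skewPair P m' s ≡ 0
        lastRowP = ∑-≡0 m λ s _ → cong (_* 𝟙 (P m s)) (𝟙-outside′ m' (suc s) (m≤m′+1+s s))

darkCount-substitute : ∀ n' m .{{_ : NonZero m}} P →
  darkCount (suc n' * m) (substitute (suc n') m P) ≡ Tri (suc n') * darkCount m P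
darkCount-substitute n' (suc m') = Substitution.darkCount-substitute n' m'

bStepCount-substitute : ∀ n' m .{{_ : NonZero m}} P → InTriangle m P → P 0 0 ≡ true → P 0 (pred m) ≡ true →
  bStepCount (suc n' * m) (substitute (suc n') m P) ≡ Tri (suc n') * bStepCount m P + Tri n'
bStepCount-substitute n' (suc m') P = Substitution.bStepCount-substitute n' m' P

skewCount-substitute : ∀ n' m .{{_ : NonZero m}} P → InTriangle m P → P 0 (pred m) ≡ true → P (pred m) 0 ≡ true →
  skewCount (suc n' * m) (substitute (suc n') m P) ≡ Tri (suc n') * skewCount m P + Tri n'
skewCount-substitute n' (suc m') P = Substitution.skewCount-substitute n' m' P

-- The patterns F_n(k)

∧-true : ∀ {x y} → x ∧ y ≡ true → x ≡ true × y ≡ true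
∧-true {true} y≡true = refl , y≡true

module _ (n' : ℕ) where

  private
    n = suc n'

  darkF-sym : ∀ k a b → darkF n k a b ≡ darkF n k b a
  darkF-sym zero    a b = ∧-comm (a ≡ᵇ 0) (b ≡ᵇ 0)
  darkF-sym (suc k) a b = cong₂ _∧_ (cong (_≤ᵇ n') (+-comm (a / m) (b / m))) (darkF-sym k (a % m) (b % m))
    where
    m = n ^ k
    instance _ = m^n≢0 n k

  darkF-inTriangle : ∀ k → InTriangle (n ^ k) (darkF n k)
  darkF-inTriangle zero    zero zero _ = s≤s z≤n
  darkF-inTriangle (suc k) a    b    dark = begin-strict
    a + b                                         ≡⟨ cong₂ _+_ (m≡m%n+[m/n]*n a m) (m≡m%n+[m/n]*n b m) ⟩
    (a % m + a / m * m) + (b % m + b / m * m)     ≡⟨ +-interchange (a % m) _ _ _ ⟩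
    (a % m + b % m) + (a / m * m + b / m * m)     <⟨ +-monoˡ-< _ (darkF-inTriangle k (a % m) (b % m) patternDark) ⟩
    m + (a / m * m + b / m * m)                   ≡⟨ cong (m +_) (*-distribʳ-+ m (a / m) (b / m)) ⟨
    suc (a / m + b / m) * m                       ≤⟨ *-monoˡ-≤ m (s≤s (≤ᵇ⇒≤ (a / m + b / m) n' generatorDark)) ⟩
    n * m                                         ∎
    where
    open ≤-Reasoning
    m = n ^ k
    instance _ = m^n≢0 n k
    generatorDark : T (darkGen n (a / m) (b / m))
    generatorDark = Equivalence.from T-≡ (proj₁ (∧-true dark))
    patternDark : darkF n k (a % m) (b % m) ≡ true
    patternDark = proj₂ (∧-true dark)

  darkF-leftEdge : ∀ k b → b < n ^ k → darkF n k 0 b ≡ true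
  darkF-leftEdge zero    zero    _           = refl
  darkF-leftEdge zero    (suc b) (s≤s ())
  darkF-leftEdge (suc k) b       b<nm = begin
    darkGen n (0 / m) (b / m) ∧ darkF n k (0 % m) (b % m)
      ≡⟨ cong₂ (λ x y → darkGen n x (b / m) ∧ darkF n k y (b % m)) (0/n≡0 m) (m<n⇒m%n≡m (>-nonZero⁻¹ m)) ⟩
    (b / m ≤ᵇ n') ∧ darkF n k 0 (b % m)
      ≡⟨ cong₂ _∧_ (Equivalence.to T-≡ (≤⇒≤ᵇ (≤-pred (m<n*o⇒m/o<n b<nm))))
                   (darkF-leftEdge k (b % m) (m%n<n b m)) ⟩
    true ∎
    where
    open ≡-Reasoning
    m = n ^ k
    instance _ = m^n≢0 n k

  private
    pred<self : ∀ m .{{_ : NonZero m}} → pred m < m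
    pred<self (suc m) = ≤-refl

    D : ℕ → Pattern
    D = darkF n

    corner₀₀ : ∀ k → D k 0 0 ≡ true
    corner₀₀ k = darkF-leftEdge k 0 (>-nonZero⁻¹ (n ^ k) {{m^n≢0 n k}})

    corner₀ₘ : ∀ k → D k 0 (pred (n ^ k)) ≡ true
    corner₀ₘ k = darkF-leftEdge k _ (pred<self (n ^ k) {{m^n≢0 n k}})

    cornerₘ₀ : ∀ k → D k (pred (n ^ k)) 0 ≡ true
    cornerₘ₀ k = trans (darkF-sym k _ 0) (corner₀ₘ k)

  -- darkF n (suc k) unfolds definitionally to substitute n (n ^ k) (darkF n k).
  darkCount-darkF : ∀ k → darkCount (n ^ k) (D k) ≡ Tri n ^ k
  darkCount-darkF zero    = refl
  darkCount-darkF (suc k) =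
    trans (darkCount-substitute n' (n ^ k) {{m^n≢0 n k}} (D k)) (cong (Tri n *_) (darkCount-darkF k))

  bStepCount-darkF : ∀ k → bStepCount (n ^ k) (D k) ≡ ∑[ j < k ] (Tri n' * Tri n ^ j)
  bStepCount-darkF = ∑-affineRecurrence (λ k → bStepCount (n ^ k) (D k)) (Tri n') (Tri n) refl λ k →
    bStepCount-substitute n' (n ^ k) {{m^n≢0 n k}} (D k) (darkF-inTriangle k) (corner₀₀ k) (corner₀ₘ k)

  skewCount-darkF : ∀ k → skewCount (n ^ k) (D k) ≡ ∑[ j < k ] (Tri n' * Tri n ^ j)
  skewCount-darkF = ∑-affineRecurrence (λ k → skewCount (n ^ k) (D k)) (Tri n') (Tri n) refl λ k →
    skewCount-substitute n' (n ^ k) {{m^n≢0 n k}} (D k) (darkF-inTriangle k) (corner₀ₘ k) (cornerₘ₀ k)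

  numVertices≡Tri^k : ∀ k → numVertices n k ≡ Tri n ^ k
  numVertices≡Tri^k k = trans (length-darkTiles (n ^ k) (D k)) (darkCount-darkF k)

  numEdges≡edgeFormula : ∀ k → numEdges n k ≡ edgeFormula n k
  numEdges≡edgeFormula k = begin
    numEdges n k
      ≡⟨ EdgeCount.length-adjacentPairs (n ^ k) (D k) (darkF-inTriangle k) ⟩
    bStepCount (n ^ k) (D k) + aStepCount (n ^ k) (D k) + skewCount (n ^ k) (D k)
      ≡⟨ cong₂ _+_ (cong₂ _+_ (bStepCount-darkF k)
                              (trans (aStepCount≡bStepCount (n ^ k) (D k) (darkF-sym k)) (bStepCount-darkF k)))
                   (skewCount-darkF k) ⟩
    X + X + X
      ≡⟨ triple X ⟩
    3 * X
      ≡⟨ ∑-*ˡ k 3 _ ⟨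
    ∑[ j < k ] (3 * (Tri n' * Tri n ^ j))
      ≡⟨ ∑-cong k (λ j → *-assoc 3 (Tri n') (Tri n ^ j)) ⟨
    ∑[ j < k ] (3 * Tri n' * Tri n ^ j)
      ≡⟨ sumMap-applyUpTo (λ j → 3 * Tri n' * Tri n ^ j) id k ⟨
    edgeFormula n k ∎
    where
    open ≡-Reasoning
    X = ∑[ j < k ] (Tri n' * Tri n ^ j)
    triple : ∀ x → x + x + x ≡ 3 * x
    triple = solve-∀

mainTheorem3 : (n k : ℕ) → .{{_ : NonZero n}} → 2 ≤ n → 1 ≤ k →
    (numVertices n k ≡ Tri n ^ k) × (numEdges n k ≡ edgeFormula n k)
mainTheorem3 (suc n') k _ _ = numVertices≡Tri^k n' k , numEdges≡edgeFormula n' k
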